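{- Let $p\ge3$ be a prime and let $k_1,k_2$ be integers satisfying $k_1\ge0.4(p-1)$ and $k_2\ge0.4(p-1)$. Then the interval $\mathcal{I}=\{n\in\mathbb{Z}:\ -k_1\le n\le k_2\}\pmod p$ admits a nontrivial multiplicative decomposition.
   Context: $\mathbb{F}_p$ is the field of residues modulo the prime $p$. For $\mathcal{A},\mathcal{B}\subset\mathbb{F}_p$, $\mathcal{A}\mathcal{B}=\{ab:\ a\in\mathcal{A},\ b\in\mathcal{B}\}$. A set $\mathcal{S}\subset\mathbb{F}_p$ is said to admit (have) a nontrivial multiplicative decomposition if $\mathcal{S}\setminus\{0\}=\mathcal{A}\mathcal{B}$ for some sets $\mathcal{A},\mathcal{B}\subset\mathbb{F}_p$ with $|\mathcal{A}|\ge2$ and $|\mathcal{B}|\ge2$. -}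

module Defs where

open import Data.Nat using (ℕ; _*_; NonZero)
open import Data.Nat.DivMod using (_mod_)
open import Data.Integer as ℤ using (ℤ; +_; -_; _%ℕ_)
open import Data.Fin using (Fin; toℕ)
open import Data.Product using (Σ; _×_; ∃; ∃-syntax)
open import Function.Bundles using (_⇔_)
open import Relation.Binary.PropositionalEquality using (_≡_; _≢_)
open import Relation.Nullary using (¬_)

_·_ : {p : ℕ} .{{_ : NonZero p}} → Fin p → Fin p → Fin p
_·_ {p} a b = (toℕ a * toℕ b) mod p

Subset : ℕ → Set₁
Subset p = Fin p → Set

_⊙_ : {p : ℕ} .{{_ : NonZero p}} → Subset p → Subset p → Subset p
(A ⊙ B) x = ∃[ a ] ∃[ b ] (A a × B b × x ≡ a · b)

AtLeastTwo : {p : ℕ} → Subset p → Set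
AtLeastTwo A = ∃[ a ] ∃[ a′ ] (A a × A a′ × a ≢ a′)

HasNontrivialMultDecomp : (p : ℕ) .{{_ : NonZero p}} → Subset p → Set₁
HasNontrivialMultDecomp p S =
  Σ (Subset p) λ A → Σ (Subset p) λ B →
    AtLeastTwo A × AtLeastTwo B ×
    (∀ x → (S x × toℕ x ≢ 0) ⇔ (A ⊙ B) x)

Interval : (p : ℕ) .{{_ : NonZero p}} → ℤ → ℤ → Subset p
Interval p k₁ k₂ x = ∃[ n ] ((- k₁ ℤ.≤ n) × (n ℤ.≤ k₂) × n %ℕ p ≡ toℕ x)

{-# OPTIONS --safe #-}
-- Take B = {1, 2} and A = {z ≠ 0 : z, 2z ∈ I}. Then AB ⊆ I \ {0}, and a nonzero x ∈ I
-- is x·1 when 2x ∈ I and (x/2)·2 when x/2 ∈ I, so it suffices that y ∈ I or 4y ∈ I for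
-- every y (take y = x/2). The complement of I is the arc G = (b, p − a) of length at most
-- (p − 1)/5, and the bounds on a and b put 4w strictly between u + p and u + 2p for all
-- w, u ∈ G, so 4G misses G. Finally ±1 ∈ A, since ±1, ±2 ∈ I.
module Submission where

open import Defs
open import Data.Nat using (ℕ; NonZero; _≤_)
open import Data.Nat.Primality using (Prime)
open import Data.Integer as ℤ using (ℤ; +_)

open import Data.Nat using (zero; suc; _+_; _*_; _∸_; _<_; z≤n; s≤s; s≤s⁻¹; _≤?_)
open import Data.Nat.Properties
open import Data.Nat.DivMod
open import Algebra.Properties.CommutativeSemigroup *-commutativeSemigroup using (xy∙z≈xz∙y)
open import Data.Nat.Divisibility using (m%n≡0⇒n∣m)
open import Data.Nat.Primality using (composite; prime⇒¬composite)
open import Data.Nat.Tactic.RingSolver using (solve; solve-∀)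
open import Data.Integer using (+≤+; -≤+)
open import Data.Integer.Properties using (drop‿+≤+; pos-*; neg-≤-pos; neg-mono-≤; neg-cancel-≤)
open import Data.Fin using (Fin; toℕ; fromℕ<)
open import Data.Fin.Properties using (toℕ-fromℕ<; toℕ-injective; toℕ<n)
open import Data.List using ([]; _∷_)
open import Data.Product using (∃-syntax; _×_; _,_)
open import Data.Sum using (_⊎_; inj₁; inj₂)
open import Data.Empty using (⊥)
open import Function using (_∘_)
open import Function.Bundles using (_⇔_; mk⇔; module Equivalence)
open import Relation.Nullary using (¬_; Dec; yes; no; contradiction)
open import Relation.Nullary.Decidable using (_⊎-dec_; decidable-stable)
open import Relation.Binary.PropositionalEquality

infixl 6 _⊕_
_⊕_ : ∀ {m n o q} → m ≤ n → o ≤ q → m + o ≤ n + q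
_⊕_ = +-mono-≤

[m%d*n]%d≡[m*n]%d : ∀ m n d .{{_ : NonZero d}} → (m % d * n) % d ≡ (m * n) % d
[m%d*n]%d≡[m*n]%d m n d = begin
  (m % d * n) % d            ≡⟨ %-distribˡ-* (m % d) n d ⟩
  (m % d % d * (n % d)) % d  ≡⟨ cong (λ t → (t * (n % d)) % d) (m%n%n≡m%n m d) ⟩
  (m % d * (n % d)) % d      ≡⟨ %-distribˡ-* m n d ⟨
  (m * n) % d                ∎
  where open ≡-Reasoning

%-not-between : ∀ m d .{{_ : NonZero d}} → m % d + d < m → m < m % d + 2 * d → ⊥
%-not-between m d lo hi = no-multiple (m / d) (m≡m%n+[m/n]*n m d)
  where
  r : ℕ
  r = m % d
  no-multiple : ∀ q → m ≡ r + q * d → ⊥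
  no-multiple zero          m≡r   = <⇒≱ lo (≤-trans (≤-reflexive m≡r) (+-monoʳ-≤ r z≤n))
  no-multiple (suc zero)    m≡r+d = <⇒≱ lo (≤-reflexive (trans m≡r+d (cong (_+_ r) (+-identityʳ d))))
  no-multiple (suc (suc q)) m≡r+kd =
    <⇒≱ hi (≤-trans (+-monoʳ-≤ r (+-monoʳ-≤ d (+-monoʳ-≤ d z≤n))) (≤-reflexive (sym m≡r+kd)))

-[1+n]%ℕd≡d∸[1+n] : ∀ n d .{{_ : NonZero d}} → suc n ≤ d → ℤ.-[1+ n ] ℤ.%ℕ d ≡ d ∸ suc n
-[1+n]%ℕd≡d∸[1+n] n d 1+n≤d with m≤n⇒m<n∨m≡n 1+n≤d
... | inj₁ 1+n<d rewrite m<n⇒m%n≡m 1+n<d = refl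
... | inj₂ refl rewrite n%n≡0 (suc n) {{_}} = sym (n∸n≡0 (suc n))

-[1+n]%ℕd≡0⊎d≤-[1+n]%ℕd+1+n : ∀ n d .{{_ : NonZero d}} →
  ℤ.-[1+ n ] ℤ.%ℕ d ≡ 0 ⊎ d ≤ ℤ.-[1+ n ] ℤ.%ℕ d + suc n
-[1+n]%ℕd≡0⊎d≤-[1+n]%ℕd+1+n n d with suc n % d in r≡
... | zero  = inj₁ refl
... | suc r = inj₂ (≤-trans (≤-reflexive (sym (m∸n+n≡m r<d))) (+-monoʳ-≤ (d ∸ suc r) r≤1+n))
  where
  r<d : suc r ≤ d
  r<d = subst (_≤ d) r≡ (m%n≤n (suc n) d)
  r≤1+n : suc r ≤ suc n
  r≤1+n = subst (_≤ suc n) r≡ (m%n≤m (suc n) d)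

Arc : (p a b : ℕ) → ℕ → Set
Arc p a b v = v ≤ b ⊎ p ≤ v + a

arc? : ∀ p a b v → Dec (Arc p a b v)
arc? p a b v = (v ≤? b) ⊎-dec (p ≤? v + a)

Interval⇔Arc : ∀ p a b .{{_ : NonZero p}} (x : Fin p) → Interval p (+ a) (+ b) x ⇔ Arc p a b (toℕ x)
Interval⇔Arc p a b x = mk⇔ to from
  where
  v : ℕ
  v = toℕ x
  to : Interval p (+ a) (+ b) x → Arc p a b v
  to (+ m , _ , +≤+ m≤b , m%p≡v) = inj₁ (subst (_≤ b) m%p≡v (≤-trans (m%n≤m m p) m≤b))
  to (ℤ.-[1+ m ] , -a≤n , _ , r≡v) with -[1+n]%ℕd≡0⊎d≤-[1+n]%ℕd+1+n m p
  ... | inj₁ r≡0 = inj₁ (subst (_≤ b) (trans (sym r≡0) r≡v) z≤n)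
  ... | inj₂ p≤r+1+m = inj₂ (≤-trans p≤r+1+m (≤-reflexive r≡v ⊕ drop‿+≤+ (neg-cancel-≤ -a≤n)))
  from : Arc p a b v → Interval p (+ a) (+ b) x
  from (inj₁ v≤b) = + v , neg-≤-pos , +≤+ v≤b , m<n⇒m%n≡m (toℕ<n x)
  from (inj₂ p≤v+a) =
    ℤ.-[1+ d ] , neg-mono-≤ (+≤+ (subst (_≤ a) (sym 1+d≡p∸v) (m≤n+o⇒m∸n≤o p v p≤v+a))) , -≤+ ,
      trans (-[1+n]%ℕd≡d∸[1+n] d p (subst (_≤ p) (sym 1+d≡p∸v) (m∸n≤m p v)))
            (trans (cong (p ∸_) 1+d≡p∸v) (m∸[m∸n]≡n (<⇒≤ (toℕ<n x))))
    where
    d : ℕ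
    d = p ∸ suc v
    1+d≡p∸v : suc d ≡ p ∸ v
    1+d≡p∸v = sym (+-∸-assoc 1 (toℕ<n x))

module _ (p a b : ℕ) (2p≤2+5a : 2 * p ≤ 2 + 5 * a) (2p≤2+5b : 2 * p ≤ 2 + 5 * b) where

  -- In both bounds, 5 × (goal) is a nonnegative combination of the hypotheses.
  gap*4>gap+p : ∀ {u w} → u + a < p → b < w → u + p < w * 4
  gap*4>gap+p {u} {w} u+a<p b<w =
    ≤-trans (m≤n+m (suc (u + p)) 2) (*-cancelˡ-≤ 5 (+-cancelˡ-≤ (5 * p + 5 * a + 20 * b + 10) _ _ (begin
      5 * p + 5 * a + 20 * b + 10 + 5 * (3 + (u + p))     ≡⟨ solve (u ∷ p ∷ a ∷ b ∷ []) ⟩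
      5 * suc (u + a) + 20 * suc b + 2 * p + 4 * (2 * p)  ≤⟨ *-monoʳ-≤ 5 u+a<p ⊕ *-monoʳ-≤ 20 b<w
                                                             ⊕ 2p≤2+5a ⊕ *-monoʳ-≤ 4 2p≤2+5b ⟩
      5 * p + 20 * w + (2 + 5 * a) + 4 * (2 + 5 * b)      ≡⟨ solve (w ∷ p ∷ a ∷ b ∷ []) ⟩
      5 * p + 5 * a + 20 * b + 10 + 5 * (w * 4)           ∎)))
    where open ≤-Reasoning

  gap*4<gap+2p : ∀ {u w} → w + a < p → b < u → w * 4 < u + 2 * p
  gap*4<gap+2p {u} {w} w+a<p b<u =
    ≤-trans (m≤n+m (suc (w * 4)) 2) (*-cancelˡ-≤ 5 (+-cancelˡ-≤ (20 * a + 5 * b + 10 * p + 10) _ _ (begin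
      20 * a + 5 * b + 10 * p + 10 + 5 * (3 + w * 4)      ≡⟨ solve (w ∷ p ∷ a ∷ b ∷ []) ⟩
      20 * suc (w + a) + 5 * suc b + 2 * p + 4 * (2 * p)  ≤⟨ *-monoʳ-≤ 20 w+a<p ⊕ *-monoʳ-≤ 5 b<u
                                                             ⊕ 2p≤2+5b ⊕ *-monoʳ-≤ 4 2p≤2+5a ⟩
      20 * p + 5 * u + (2 + 5 * b) + 4 * (2 + 5 * a)      ≡⟨ solve (u ∷ p ∷ a ∷ b ∷ []) ⟩
      20 * a + 5 * b + 10 * p + 10 + 5 * (u + 2 * p)      ∎)))
    where open ≤-Reasoning

  ∉Arc⇒*4∈Arc : .{{_ : NonZero p}} → ∀ w → ¬ Arc p a b w → Arc p a b (w * 4 % p)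
  ∉Arc⇒*4∈Arc w w∉ = decidable-stable (arc? p a b (w * 4 % p)) λ u∉ →
    %-not-between (w * 4) p (gap*4>gap+p (above u∉) (below w∉)) (gap*4<gap+2p (above w∉) (below u∉))
    where
    below : ∀ {v} → ¬ Arc p a b v → b < v
    below v∉ = ≰⇒> (v∉ ∘ inj₁)
    above : ∀ {v} → ¬ Arc p a b v → v + a < p
    above v∉ = ≰⇒> (v∉ ∘ inj₂)

module OddModulus (p h : ℕ) .{{_ : NonZero p}} (2<p : 2 < p) (1+p≡2h : suc p ≡ 2 * h) where

  toℕ-· : ∀ x y → toℕ (x · y) ≡ toℕ x * toℕ y % p
  toℕ-· x y = toℕ-fromℕ< _

  ·-comm : ∀ x y → x · y ≡ y · x
  ·-comm x y = toℕ-injective (begin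
    toℕ (x · y)          ≡⟨ toℕ-· x y ⟩
    toℕ x * toℕ y % p    ≡⟨ cong (_% p) (*-comm (toℕ x) (toℕ y)) ⟩
    toℕ y * toℕ x % p    ≡⟨ toℕ-· y x ⟨
    toℕ (y · x)          ∎)
    where open ≡-Reasoning

  one two : Fin p
  one = fromℕ< (<⇒≤ 2<p)
  two = fromℕ< 2<p

  toℕ-one : toℕ one ≡ 1
  toℕ-one = toℕ-fromℕ< _

  toℕ-two : toℕ two ≡ 2
  toℕ-two = toℕ-fromℕ< _

  one≢two : one ≢ two
  one≢two 1≡2 with trans (sym toℕ-one) (trans (cong toℕ 1≡2) toℕ-two)
  ... | ()

  ·-identityʳ : ∀ x → x · one ≡ x
  ·-identityʳ x = toℕ-injective (begin
    toℕ (x · one)        ≡⟨ toℕ-· x one ⟩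
    toℕ x * toℕ one % p  ≡⟨ cong (λ t → toℕ x * t % p) toℕ-one ⟩
    toℕ x * 1 % p        ≡⟨ cong (_% p) (*-identityʳ (toℕ x)) ⟩
    toℕ x % p            ≡⟨ m<n⇒m%n≡m (toℕ<n x) ⟩
    toℕ x                ∎)
    where open ≡-Reasoning

  toℕ-·two : ∀ x → toℕ (x · two) ≡ toℕ x * 2 % p
  toℕ-·two x = trans (toℕ-· x two) (cong (λ t → toℕ x * t % p) toℕ-two)

  *2*h%p : ∀ m → m * 2 * h % p ≡ m % p
  *2*h%p m = begin
    m * 2 * h % p    ≡⟨ cong (_% p) (*-assoc m 2 h) ⟩
    m * (2 * h) % p  ≡⟨ cong (λ t → m * t % p) (sym 1+p≡2h) ⟩
    m * suc p % p    ≡⟨ cong (_% p) (*-suc m p) ⟩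
    (m + m * p) % p  ≡⟨ [m+kn]%n≡m%n m m p ⟩
    m % p            ∎
    where open ≡-Reasoning

  half : Fin p → Fin p
  half x = toℕ x * h mod p

  toℕ-half : ∀ x → toℕ (half x) ≡ toℕ x * h % p
  toℕ-half x = toℕ-fromℕ< (m%n<n (toℕ x * h) p)

  half-·two : ∀ x → half x · two ≡ x
  half-·two x = toℕ-injective (begin
    toℕ (half x · two)     ≡⟨ toℕ-·two (half x) ⟩
    toℕ (half x) * 2 % p   ≡⟨ cong (λ t → t * 2 % p) (toℕ-half x) ⟩
    toℕ x * h % p * 2 % p  ≡⟨ [m%d*n]%d≡[m*n]%d (toℕ x * h) 2 p ⟩
    toℕ x * h * 2 % p      ≡⟨ cong (_% p) (xy∙z≈xz∙y (toℕ x) h 2) ⟩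
    toℕ x * 2 * h % p      ≡⟨ *2*h%p (toℕ x) ⟩
    toℕ x % p              ≡⟨ m<n⇒m%n≡m (toℕ<n x) ⟩
    toℕ x                  ∎)
    where open ≡-Reasoning

  ·two≢0 : ∀ {x} → toℕ x ≢ 0 → toℕ (x · two) ≢ 0
  ·two≢0 {x} x≢0 2x≡0 = x≢0 (begin
    toℕ x                      ≡⟨ m<n⇒m%n≡m (toℕ<n x) ⟨
    toℕ x % p                  ≡⟨ *2*h%p (toℕ x) ⟨
    toℕ x * 2 * h % p          ≡⟨ [m%d*n]%d≡[m*n]%d (toℕ x * 2) h p ⟨
    toℕ x * 2 % p * h % p      ≡⟨ cong (λ t → t * h % p) (trans (sym (toℕ-·two x)) 2x≡0) ⟩
    0 % p                      ≡⟨ m*n%n≡0 0 p ⟩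
    0                          ∎)
    where open ≡-Reasoning

  half≢0 : ∀ {x} → toℕ x ≢ 0 → toℕ (half x) ≢ 0
  half≢0 {x} x≢0 half≡0 = x≢0 (begin
    toℕ x                  ≡⟨ cong toℕ (half-·two x) ⟨
    toℕ (half x · two)     ≡⟨ toℕ-·two (half x) ⟩
    toℕ (half x) * 2 % p   ≡⟨ cong (λ t → t * 2 % p) half≡0 ⟩
    0 % p                  ≡⟨ m*n%n≡0 0 p ⟩
    0                      ∎)
    where open ≡-Reasoning

  WithDouble : Subset p → Subset p
  WithDouble S z = toℕ z ≢ 0 × S z × S (z · two)

  OneTwo : Subset p
  OneTwo z = z ≡ one ⊎ z ≡ two

  doubling-decomposition : (S : Subset p) → (∀ y → S y ⊎ S ((y · two) · two)) →
    AtLeastTwo (WithDouble S) → HasNontrivialMultDecomp p S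
  doubling-decomposition S y∨4y∈S A₂ =
    WithDouble S , OneTwo , A₂ , (one , two , inj₁ refl , inj₂ refl , one≢two) , λ x → mk⇔ (split x) (merge x)
    where
    split : ∀ x → S x × toℕ x ≢ 0 → (WithDouble S ⊙ OneTwo) x
    split x (x∈S , x≢0) with y∨4y∈S (half x)
    ... | inj₁ y∈S =
      half x , two , (half≢0 x≢0 , y∈S , subst S (sym (half-·two x)) x∈S) , inj₂ refl , sym (half-·two x)
    ... | inj₂ 4y∈S =
      x , one , (x≢0 , x∈S , subst S (cong (_· two) (half-·two x)) 4y∈S) , inj₁ refl , sym (·-identityʳ x)
    merge : ∀ x → (WithDouble S ⊙ OneTwo) x → S x × toℕ x ≢ 0
    merge _ (z , _ , (z≢0 , z∈S , _) , inj₁ refl , refl) =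
      subst (λ t → S t × toℕ t ≢ 0) (sym (·-identityʳ z)) (z∈S , z≢0)
    merge _ (z , _ , (z≢0 , _ , 2z∈S) , inj₂ refl , refl) = 2z∈S , ·two≢0 z≢0

1≤k : ∀ {p k} → 2 < p → 2 * p ≤ 2 + 5 * k → 1 ≤ k
1≤k {k = suc _} _ _ = s≤s z≤n
1≤k {k = zero} 2<p 2p≤2 = contradiction (≤-trans (*-monoʳ-≤ 2 2<p) 2p≤2) λ { (s≤s (s≤s ())) }

2≤k⊎p≤2+k′ : ∀ {p k k′} → 2 < p → 2 * p ≤ 2 + 5 * k → 2 * p ≤ 2 + 5 * k′ → 2 ≤ k ⊎ p ≤ 2 + k′
2≤k⊎p≤2+k′ {k = suc (suc _)} _ _ _ = inj₁ (s≤s (s≤s z≤n))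
2≤k⊎p≤2+k′ {k = zero} 2<p 2p≤2 _ = contradiction (1≤k {k = 0} 2<p 2p≤2) λ ()
2≤k⊎p≤2+k′ {p} {k = suc zero} 2<p 2p≤7 2p≤2+5k′ = inj₂ (≤-trans p≤3 (s≤s (s≤s (1≤k 2<p 2p≤2+5k′))))
  where
  p≤3 : p ≤ 3
  p≤3 = s≤s⁻¹ (*-cancelˡ-< 2 p 4 (s≤s 2p≤7))

[n∸1]*2≡n∸2+n : ∀ {n} → 2 ≤ n → (n ∸ 1) * 2 ≡ n ∸ 2 + n
[n∸1]*2≡n∸2+n {suc zero} (s≤s ())
[n∸1]*2≡n∸2+n {suc (suc r)} _ = [1+r]*2≡r+[2+r] r
  where
  [1+r]*2≡r+[2+r] : ∀ r → suc r * 2 ≡ r + suc (suc r)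
  [1+r]*2≡r+[2+r] = solve-∀

module IntervalDecomposition (p h a b : ℕ) .{{_ : NonZero p}} (2<p : 2 < p) (1+p≡2h : suc p ≡ 2 * h)
  (2p≤2+5a : 2 * p ≤ 2 + 5 * a) (2p≤2+5b : 2 * p ≤ 2 + 5 * b) where

  open OddModulus p h 2<p 1+p≡2h

  S : Subset p
  S = Interval p (+ a) (+ b)

  ∈S : ∀ {x} → Arc p a b (toℕ x) → S x
  ∈S = Equivalence.from (Interval⇔Arc p a b _)

  toℕ-·four : ∀ y → toℕ ((y · two) · two) ≡ toℕ y * 4 % p
  toℕ-·four y = begin
    toℕ ((y · two) · two)  ≡⟨ toℕ-·two (y · two) ⟩
    toℕ (y · two) * 2 % p  ≡⟨ cong (λ t → t * 2 % p) (toℕ-·two y) ⟩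
    toℕ y * 2 % p * 2 % p  ≡⟨ [m%d*n]%d≡[m*n]%d (toℕ y * 2) 2 p ⟩
    toℕ y * 2 * 2 % p      ≡⟨ cong (_% p) (*-assoc (toℕ y) 2 2) ⟩
    toℕ y * 4 % p          ∎
    where open ≡-Reasoning

  y∨4y∈S : ∀ y → S y ⊎ S ((y · two) · two)
  y∨4y∈S y with arc? p a b (toℕ y)
  ... | yes y∈ = inj₁ (∈S y∈)
  ... | no y∉ =
    inj₂ (∈S (subst (Arc p a b) (sym (toℕ-·four y)) (∉Arc⇒*4∈Arc p a b 2p≤2+5a 2p≤2+5b (toℕ y) y∉)))

  p≤p∸n+k : ∀ {n k} → n ≤ p → n ≤ k → p ≤ p ∸ n + k
  p≤p∸n+k {n} n≤p n≤k = ≤-trans (≤-reflexive (sym (m∸n+n≡m n≤p))) (+-monoʳ-≤ (p ∸ n) n≤k)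

  toℕ-one·two : toℕ (one · two) ≡ 2
  toℕ-one·two = trans (cong toℕ (trans (·-comm one two) (·-identityʳ two))) toℕ-two

  one∈A : WithDouble S one
  one∈A = (λ 1≡0 → 1≢0 (trans (sym toℕ-one) 1≡0)) ,
          ∈S (subst (Arc p a b) (sym toℕ-one) (inj₁ (1≤k 2<p 2p≤2+5b))) ,
          ∈S (subst (Arc p a b) (sym toℕ-one·two) (2≤k⊎p≤2+k′ 2<p 2p≤2+5b 2p≤2+5a))
    where
    1≢0 : 1 ≢ 0
    1≢0 ()

  p∸1<p : p ∸ 1 < p
  p∸1<p = ∸-monoʳ-< (s≤s z≤n) (<⇒≤ (<⇒≤ 2<p))

  minus-one : Fin p
  minus-one = fromℕ< p∸1<p

  toℕ-minus-one : toℕ minus-one ≡ p ∸ 1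
  toℕ-minus-one = toℕ-fromℕ< p∸1<p

  toℕ-minus-one·two : toℕ (minus-one · two) ≡ p ∸ 2
  toℕ-minus-one·two = begin
    toℕ (minus-one · two)      ≡⟨ toℕ-·two minus-one ⟩
    toℕ minus-one * 2 % p      ≡⟨ cong (λ t → t * 2 % p) toℕ-minus-one ⟩
    (p ∸ 1) * 2 % p            ≡⟨ cong (_% p) ([n∸1]*2≡n∸2+n (<⇒≤ 2<p)) ⟩
    (p ∸ 2 + p) % p            ≡⟨ [m+n]%n≡m%n (p ∸ 2) p ⟩
    (p ∸ 2) % p                ≡⟨ m<n⇒m%n≡m (∸-monoʳ-< (s≤s z≤n) (<⇒≤ 2<p)) ⟩
    p ∸ 2                      ∎
    where open ≡-Reasoning

  minus-one∈A : WithDouble S minus-one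
  minus-one∈A = (λ p∸1≡0 → m>n⇒m∸n≢0 (<⇒≤ 2<p) (trans (sym toℕ-minus-one) p∸1≡0)) ,
                ∈S (subst (Arc p a b) (sym toℕ-minus-one) (inj₂ (p≤p∸n+k (<⇒≤ (<⇒≤ 2<p)) (1≤k 2<p 2p≤2+5a)))) ,
                ∈S (subst (Arc p a b) (sym toℕ-minus-one·two) arc-p∸2)
    where
    arc-p∸2 : Arc p a b (p ∸ 2)
    arc-p∸2 with 2≤k⊎p≤2+k′ 2<p 2p≤2+5a 2p≤2+5b
    ... | inj₁ 2≤a   = inj₂ (p≤p∸n+k (<⇒≤ 2<p) 2≤a)
    ... | inj₂ p≤2+b = inj₁ (m≤n+o⇒m∸n≤o p 2 p≤2+b)

  one≢minus-one : one ≢ minus-one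
  one≢minus-one 1≡-1 with ≤-trans (∸-monoˡ-≤ 1 2<p)
                                  (≤-reflexive (trans (sym toℕ-minus-one) (trans (cong toℕ (sym 1≡-1)) toℕ-one)))
  ... | s≤s ()

  decomposition : HasNontrivialMultDecomp p S
  decomposition = doubling-decomposition S y∨4y∈S (one , minus-one , one∈A , minus-one∈A , one≢minus-one)

prime>2⇒1+p≡2h : ∀ {p} → Prime p → 2 < p → ∃[ h ] suc p ≡ 2 * h
prime>2⇒1+p≡2h {p} pr 2<p with p % 2 in p%2≡ | m≡m%n+[m/n]*n p 2
... | zero         | _       = contradiction (composite 2<p (m%n≡0⇒n∣m p 2 p%2≡)) (prime⇒¬composite pr)
... | suc zero     | p≡1+q*2 = suc (p / 2) , trans (cong suc p≡1+q*2) (*-comm (suc (p / 2)) 2)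
... | suc (suc _)  | _       = contradiction (subst (_< 2) p%2≡ (m%n<n p 2)) λ { (s≤s (s≤s ())) }

2[p∸1]≤5k⇒2p≤2+5k : ∀ {p} k → 0 < p → + (2 * (p ∸ 1)) ℤ.≤ + 5 ℤ.* + k → 2 * p ≤ 2 + 5 * k
2[p∸1]≤5k⇒2p≤2+5k {suc r} k _ 2r≤5k =
  subst (_≤ 2 + 5 * k) (sym (*-suc 2 r))
    (+-monoʳ-≤ 2 (drop‿+≤+ (subst (+ (2 * r) ℤ.≤_) (sym (pos-* 5 k)) 2r≤5k)))

theorem3 : (p : ℕ) .{{_ : NonZero p}} → Prime p → 3 ≤ p →
    (k₁ k₂ : ℤ) → + (2 Data.Nat.* (p Data.Nat.∸ 1)) ℤ.≤ + 5 ℤ.* k₁ →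
    + (2 Data.Nat.* (p Data.Nat.∸ 1)) ℤ.≤ + 5 ℤ.* k₂ →
    HasNontrivialMultDecomp p (Interval p k₁ k₂)
theorem3 p pr 2<p (+ a) (+ b) bound₁ bound₂ with prime>2⇒1+p≡2h pr 2<p
... | h , 1+p≡2h = IntervalDecomposition.decomposition p h a b 2<p 1+p≡2h
  (2[p∸1]≤5k⇒2p≤2+5k a 0<p bound₁) (2[p∸1]≤5k⇒2p≤2+5k b 0<p bound₂)
  where
  0<p : 0 < p
  0<p = ≤-trans (s≤s z≤n) 2<p
theorem3 _ _ _ ℤ.-[1+ _ ] _ () _
theorem3 _ _ _ (+ _) ℤ.-[1+ _ ] _ ()
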